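{- Let $1\le k\le n$, $w\in\mathcal{W}_{n,k}$ and $J\subseteq[n]$ with $1\le h=|J|\le k$. Then $J\in U_w$ if and only if the submatrix $M_w[[h],J]$ of $M_w$ (rows $1,\dots,h$, columns $J$) is a permutation matrix.
   Context: A Fubini word $w=w_1\cdots w_n\in\mathcal{W}_{n,k}$ is a surjection $w:[n]\to[k]$, $w_j=w(j)$. $M_w$ is the $k\times n$ matrix with $1$ at $(w_j,j)$ for each $j$, $0$ elsewhere. $\alpha_i(w)$ is the position of the first $i$ in $w$, $\mathrm{in}(w)=\{\alpha_1(w),\dots,\alpha_k(w)\}$. The pattern matrix $P_w$ is obtained from $M_w$ by replacing the $0$ in position $(w_i,j)$ by $\star$ whenever $i\in\mathrm{in}(w)$, $i<\alpha_{w_j}(w)$, and either ($j\in\mathrm{in}(w)$ and $w_i<w_j$) or $j\notin\mathrm{in}(w)$; $P_w$ also denotes the set of complex matrices obtained by substituting complex numbers for the $\star$'s. With $U$ the $k\times k$ lower unitriangular complex matrices, the PR cell is $C_w=UP_w$. The flag minor $\Delta_J(A)$ is the determinant of the submatrix of $A$ in rows $1,\dots,|J|$ and columns $J$, and $U_w=\{J\subseteq[n],\,1\le|J|\le k : \Delta_J(M)\neq0\ \forall M\in C_w\}$. A permutation matrix is a square $0/1$ matrix with exactly one $1$ in each row and each column. -}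

module Defs where

open import Level using (Level)
open import Data.Nat using (ℕ; zero; suc; _≤_)
open import Data.Fin using (Fin; zero; suc; _<_; _≟_; inject≤; punchIn)
open import Data.Maybe using (Maybe; just; nothing; map)
open import Data.Product using (Σ; ∃; _×_; _,_)
open import Data.Sum using (_⊎_)
open import Relation.Nullary using (¬_; yes; no)
open import Relation.Binary.PropositionalEquality using (_≡_)
open import Algebra.Bundles using (CommutativeRing)

-- Indices are 0-based: positions [n] ~ Fin n, letters [k] ~ Fin k, rows ~ Fin k.

-- Fubini word: a surjection [n] → [k].
Surj : {n k : ℕ} → (Fin n → Fin k) → Set
Surj {n} {k} w = (v : Fin k) → ∃ λ j → w j ≡ v

firstOcc : {n k : ℕ} → (Fin n → Fin k) → Fin k → Maybe (Fin n)
firstOcc {zero}  w v = nothing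
firstOcc {suc n} w v with w zero ≟ v
... | yes _ = just zero
... | no  _ = map suc (firstOcc (λ j → w (suc j)) v)

InIn : {n k : ℕ} → (Fin n → Fin k) → Fin n → Set
InIn w j = firstOcc w (w j) ≡ just j

BeforeFirst : {n k : ℕ} → (Fin n → Fin k) → Fin n → Fin k → Set
BeforeFirst w i v = ∀ p → firstOcc w v ≡ just p → i < p

Star : {n k : ℕ} → (Fin n → Fin k) → Fin k → Fin n → Set
Star w r j = Σ _ λ i → w i ≡ r × InIn w i × BeforeFirst w i (w j)
                 × ((InIn w j × w i < w j) ⊎ ¬ InIn w j)

Mat : {a : Level} → Set a → ℕ → ℕ → Set a
Mat A m p = Fin m → Fin p → A

Mw : {a : Level} {A : Set a} → A → A → {n k : ℕ} → (Fin n → Fin k) → Mat A k n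
Mw z o w r j with w j ≟ r
... | yes _ = o
... | no  _ = z

Mwℕ : {n k : ℕ} → (Fin n → Fin k) → Mat ℕ k n
Mwℕ = Mw 0 1

subMatrix : {a : Level} {A : Set a} {n k h : ℕ} → Mat A k n → h ≤ k → (Fin h → Fin n) → Mat A h h
subMatrix M h≤k J a b = M (inject≤ a h≤k) (J b)

-- A subset J ⊆ [n] of size h, given by its increasing enumeration.
StrictlyIncreasing : {h n : ℕ} → (Fin h → Fin n) → Set
StrictlyIncreasing J = ∀ a b → a < b → J a < J b

ExactlyOne : {m : ℕ} → (Fin m → Set) → Set
ExactlyOne P = Σ _ λ b → P b × (∀ b' → P b' → b' ≡ b)

IsPermMatrix : {m : ℕ} → Mat ℕ m m → Set
IsPermMatrix A = (∀ a b → (A a b ≡ 0) ⊎ (A a b ≡ 1))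
               × (∀ a → ExactlyOne (λ b → A a b ≡ 1))
               × (∀ b → ExactlyOne (λ a → A a b ≡ 1))

module RingDefs {c ℓ : Level} (R : CommutativeRing c ℓ) where
  open CommutativeRing R using (Carrier; _≈_; _+_; _*_; -_; 0#; 1#)

  sumF : {m : ℕ} → (Fin m → Carrier) → Carrier
  sumF {zero}  f = 0#
  sumF {suc m} f = f zero + sumF (λ i → f (suc i))

  _⊗_ : {m p q : ℕ} → Mat Carrier m p → Mat Carrier p q → Mat Carrier m q
  (A ⊗ B) i j = sumF (λ t → A i t * B t j)

  altSign : {m : ℕ} → Fin m → Carrier → Carrier
  altSign zero    x = x
  altSign (suc j) x = - altSign j x

  det : {m : ℕ} → Mat Carrier m m → Carrier
  det {zero}  A = 1#
  det {suc m} A = sumF (λ j → altSign j (A zero j * det (λ a b → A (suc a) (punchIn j b))))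

  Δ : {k n h : ℕ} → h ≤ k → (Fin h → Fin n) → Mat Carrier k n → Carrier
  Δ h≤k J A = det (subMatrix A h≤k J)

  MwR : {n k : ℕ} → (Fin n → Fin k) → Mat Carrier k n
  MwR = Mw 0# 1#

  LowerUni : {k : ℕ} → Mat Carrier k k → Set ℓ
  LowerUni U = (∀ a → U a a ≈ 1#) × (∀ a b → a < b → U a b ≈ 0#)

  InP : {n k : ℕ} → (Fin n → Fin k) → Mat Carrier k n → Set ℓ
  InP w P = ∀ r j → ¬ Star w r j → P r j ≈ MwR w r j

  InC : {n k : ℕ} → (Fin n → Fin k) → Mat Carrier k n → Set (c Level.⊔ ℓ)
  InC w M = Σ _ λ U → Σ _ λ P → LowerUni U × InP w P × (∀ r j → M r j ≈ (U ⊗ P) r j)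

  InU : {n k h : ℕ} → (Fin n → Fin k) → h ≤ k → (Fin h → Fin n) → Set (c Level.⊔ ℓ)
  InU w h≤k J = ∀ M → InC w M → ¬ (Δ h≤k J M ≈ 0#)

module Submission where

-- (⇒) M_w lies in C_w, so Δ_J(M_w) ≠ 0. A zero column or zero row of M_w[[h],J] would kill this
-- minor, so each column has its 1 in one of the rows 1..h and every such row is hit; a surjective
-- self-map of a finite set is a bijection, and the block is a permutation matrix.
-- (⇐) For M = U P ∈ C_w, lower unitriangularity of U gives Δ_J(M) = det Q with Q = P[[h],J]. A ⋆
-- at (r, b) of P_w needs the letter r to occur first before the letter of column b, so Q = E Π for
-- the permutation matrix Π = M_w[[h],J] and an E that is unitriangular for the order of first
-- occurrences. Hence det Q = det Π = ±1, which is nonzero in a nontrivial ring.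

open import Defs
open import Level using (Level)
open import Algebra.Bundles using (CommutativeRing)
open import Data.Nat as ℕ using (ℕ; zero; suc; _≤_)
import Data.Nat.Properties as ℕ
open import Data.Fin using (Fin; zero; suc; punchIn; punchOut; toℕ; inject≤; opposite; _≟_; _<_)
open import Data.Fin.Properties
  using ( any?; suc-injective; toℕ-injective; toℕ<n; <-cmp; <⇒≢; <-irrefl; <-asym
        ; punchIn-punchOut; punchOut-punchIn; punchInᵢ≢i; punchOut-cong; punchOut-injective
        ; toℕ-inject≤; inject≤-injective; injective⇒≤; opposite-prop; opposite-involutive )
import Data.Fin.Permutation as Perm
open import Data.Fin.Permutation using (Permutation′; _⟨$⟩ʳ_; _⟨$⟩ˡ_)
open import Data.Maybe using (just; map)
open import Data.Maybe.Properties using (just-injective)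
open import Data.Product using (Σ; ∃; _×_; _,_; proj₁; proj₂)
open import Data.Sum using (_⊎_; inj₁; inj₂; [_,_]′)
open import Data.Bool using (if_then_else_)
open import Data.Vec.Functional using (updateAt)
open import Data.Vec.Functional.Properties using (updateAt-updates; updateAt-minimal)
open import Function using (_∘_; id)
open import Function.Bundles using (_⇔_; mk⇔)
open import Function.Definitions using (Injective)
open import Relation.Nullary using (¬_; Dec; yes; no; does; contradiction)
open import Relation.Nullary.Decidable using (dec-true; dec-false)
open import Relation.Binary using (tri<; tri≈; tri>)
open import Relation.Binary.PropositionalEquality as ≡
  using (_≡_; _≢_; ≢-sym)

punchIn-punchIn-comm : ∀ {n} (j c : Fin (suc (suc n))) (j≢c : j ≢ c) (c≢j : c ≢ j) (b : Fin n) →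
                       punchIn j (punchIn (punchOut j≢c) b) ≡ punchIn c (punchIn (punchOut c≢j) b)
punchIn-punchIn-comm zero    zero    j≢c _   b       = contradiction ≡.refl j≢c
punchIn-punchIn-comm zero    (suc c) _   _   b       = ≡.refl
punchIn-punchIn-comm (suc j) zero    _   _   b       = ≡.refl
punchIn-punchIn-comm {suc n} (suc j) (suc c) _   _   zero    = ≡.refl
punchIn-punchIn-comm {suc n} (suc j) (suc c) j≢c c≢j (suc b) =
  ≡.cong suc (punchIn-punchIn-comm j c (j≢c ∘ ≡.cong suc) (c≢j ∘ ≡.cong suc) b)

opposite-<-reflects : ∀ {n} {i j : Fin n} → opposite j < opposite i → i < j
opposite-<-reflects {n} {i} {j} opp-j<opp-i =
  ℕ.s<s⁻¹ (ℕ.∸-cancelʳ-< {o = n} (≡.subst₂ ℕ._<_ (opposite-prop j) (opposite-prop i) opp-j<opp-i))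

opposite-injective : ∀ {n} → Injective _≡_ _≡_ (opposite {n})
opposite-injective {n} {i} {j} opp-i≡opp-j =
  ≡.trans (≡.sym (opposite-involutive i)) (≡.trans (≡.cong opposite opp-i≡opp-j) (opposite-involutive j))

surjective⇒injective : ∀ {m} (f : Fin m → Fin m) → (∀ a → ∃ λ b → f b ≡ a) → Injective _≡_ _≡_ f
surjective⇒injective {suc m} f surj {b} {b′} fb≡fb′ with b ≟ b′
... | yes b≡b′ = b≡b′
... | no  b≢b′ = contradiction (injective⇒≤ section-injective) ℕ.1+n≰n
  where
  -- every a has a preimage other than b′, since b′ can be replaced by b
  preimage : ∀ a → ∃ λ x → b′ ≢ x × f x ≡ a
  preimage a with proj₁ (surj a) ≟ b′
  ... | yes x≡b′ = b , ≢-sym b≢b′ , ≡.trans fb≡fb′ (≡.trans (≡.cong f (≡.sym x≡b′)) (proj₂ (surj a)))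
  ... | no  x≢b′ = proj₁ (surj a) , ≢-sym x≢b′ , proj₂ (surj a)

  avoids-b′ : ∀ a → b′ ≢ proj₁ (preimage a)
  avoids-b′ a = proj₁ (proj₂ (preimage a))

  maps-to : ∀ a → f (proj₁ (preimage a)) ≡ a
  maps-to a = proj₂ (proj₂ (preimage a))

  section : Fin (suc m) → Fin m
  section a = punchOut (avoids-b′ a)

  section-injective : Injective _≡_ _≡_ section
  section-injective {a} {a′} eq =
    ≡.trans (≡.sym (maps-to a)) (≡.trans (≡.cong f (punchOut-injective (avoids-b′ a) (avoids-b′ a′) eq)) (maps-to a′))

bijection⇒IsPermMatrix : ∀ {m} (A : Mat ℕ m m) (f : Fin m → Fin m) →
               (∀ r b → f b ≡ r → A r b ≡ 1) → (∀ r b → f b ≢ r → A r b ≡ 0) →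
               (∀ a → ∃ λ b → f b ≡ a) → Injective _≡_ _≡_ f → IsPermMatrix A
bijection⇒IsPermMatrix A f A≡1 A≡0 f-surjective f-injective = entries , rows , columns
  where
  one-at : ∀ {r b} → A r b ≡ 1 → f b ≡ r
  one-at {r} {b} Arb≡1 with f b ≟ r
  ... | yes fb≡r = fb≡r
  ... | no  fb≢r = contradiction (≡.trans (≡.sym (A≡0 r b fb≢r)) Arb≡1) λ ()

  entries : ∀ r b → A r b ≡ 0 ⊎ A r b ≡ 1
  entries r b with f b ≟ r
  ... | yes fb≡r = inj₂ (A≡1 r b fb≡r)
  ... | no  fb≢r = inj₁ (A≡0 r b fb≢r)

  rows : ∀ a → ExactlyOne (λ b → A a b ≡ 1)
  rows a = b , A≡1 a b fb≡a , λ b′ Aab′≡1 → f-injective (≡.trans (one-at Aab′≡1) (≡.sym fb≡a))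
    where
    b = proj₁ (f-surjective a)
    fb≡a = proj₂ (f-surjective a)

  columns : ∀ b → ExactlyOne (λ a → A a b ≡ 1)
  columns b = f b , A≡1 (f b) b ≡.refl , λ a′ Aa′b≡1 → ≡.sym (one-at Aa′b≡1)

IsPermMatrix⇒permutation : ∀ {m} {A : Mat ℕ m m} → IsPermMatrix A →
                           Σ (Permutation′ m) λ π → ∀ b → A (π ⟨$⟩ʳ b) b ≡ 1
IsPermMatrix⇒permutation {A = A} (_ , rows , columns) =
  Perm.permutation rowOf columnOf rowOf∘columnOf columnOf∘rowOf , proj₁ ∘ proj₂ ∘ columns
  where
  rowOf columnOf : _ → Fin _
  rowOf b = proj₁ (columns b)
  columnOf a = proj₁ (rows a)

  rowOf∘columnOf : ∀ a → rowOf (columnOf a) ≡ a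
  rowOf∘columnOf a = ≡.sym (proj₂ (proj₂ (columns (columnOf a))) a (proj₁ (proj₂ (rows a))))

  columnOf∘rowOf : ∀ b → columnOf (rowOf b) ≡ b
  columnOf∘rowOf b = ≡.sym (proj₂ (proj₂ (rows (rowOf b))) b (proj₁ (proj₂ (columns b))))

-- Determinants

module Determinant {c ℓ : Level} (R : CommutativeRing c ℓ) where

  open CommutativeRing R hiding (zero)
  open RingDefs R
  open import Algebra.Properties.Ring ring using (-‿involutive; -‿distribʳ-*; -0#≈0#; -‿+-comm)
  open import Algebra.Properties.Semiring.Sum semiring using (sum; sum-remove; ∑-distrib-+; ∑-comm; *-distribˡ-sum)
  open import Algebra.Properties.CommutativeSemigroup *-commutativeSemigroup using (x∙yz≈y∙xz)
  open import Relation.Binary.Reasoning.Setoid setoid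

  sumF≡sum : ∀ {m} (f : Fin m → Carrier) → sumF f ≡ sum f
  sumF≡sum {zero}  f = ≡.refl
  sumF≡sum {suc m} f = ≡.cong (f zero +_) (sumF≡sum (f ∘ suc))

  sumF-cong : ∀ {m} {f g : Fin m → Carrier} → (∀ i → f i ≈ g i) → sumF f ≈ sumF g
  sumF-cong {zero}  f≈g = refl
  sumF-cong {suc m} f≈g = +-cong (f≈g zero) (sumF-cong (f≈g ∘ suc))

  sumF-zero : ∀ {m} {f : Fin m → Carrier} → (∀ i → f i ≈ 0#) → sumF f ≈ 0#
  sumF-zero {zero}  f≈0 = refl
  sumF-zero {suc m} f≈0 = trans (+-cong (f≈0 zero) (sumF-zero (f≈0 ∘ suc))) (+-identityˡ 0#)

  sumF-+ : ∀ {m} (f g : Fin m → Carrier) → sumF (λ i → f i + g i) ≈ sumF f + sumF g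
  sumF-+ f g rewrite sumF≡sum (λ i → f i + g i) | sumF≡sum f | sumF≡sum g = ∑-distrib-+ f g

  sumF-*ˡ : ∀ {m} x (f : Fin m → Carrier) → x * sumF f ≈ sumF (λ i → x * f i)
  sumF-*ˡ x f rewrite sumF≡sum f | sumF≡sum (λ i → x * f i) = *-distribˡ-sum x f

  sumF-remove : ∀ {m} (j : Fin (suc m)) (f : Fin (suc m) → Carrier) → sumF f ≈ f j + sumF (f ∘ punchIn j)
  sumF-remove j f rewrite sumF≡sum f | sumF≡sum (f ∘ punchIn j) = sum-remove f

  sumF-comm : ∀ {m n} (f : Fin m → Fin n → Carrier) →
              sumF (λ i → sumF (f i)) ≈ sumF (λ j → sumF (λ i → f i j))
  sumF-comm f = begin
    sumF (λ i → sumF (f i))        ≈⟨ sumF-cong (λ i → reflexive (sumF≡sum (f i))) ⟩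
    sumF (λ i → sum (f i))         ≡⟨ sumF≡sum (λ i → sum (f i)) ⟩
    sum (λ i → sum (f i))          ≈⟨ ∑-comm f ⟩
    sum (λ j → sum (λ i → f i j))  ≡⟨ sumF≡sum (λ j → sum (λ i → f i j)) ⟨
    sumF (λ j → sum (λ i → f i j)) ≈⟨ sumF-cong (λ j → reflexive (sumF≡sum (λ i → f i j))) ⟨
    sumF (λ j → sumF (λ i → f i j)) ∎

  sumF-neg : ∀ {m} (f : Fin m → Carrier) → - sumF f ≈ sumF (λ i → - f i)
  sumF-neg {zero}  f = -0#≈0#
  sumF-neg {suc m} f = trans (sym (-‿+-comm (f zero) _)) (+-congˡ (sumF-neg (f ∘ suc)))

  sumF-single : ∀ {m} (j : Fin m) {f : Fin m → Carrier} → (∀ i → i ≢ j → f i ≈ 0#) → sumF f ≈ f j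
  sumF-single {suc m} j {f} f≈0 = begin
    sumF f                      ≈⟨ sumF-remove j f ⟩
    f j + sumF (f ∘ punchIn j)  ≈⟨ +-congˡ (sumF-zero (λ i → f≈0 (punchIn j i) (punchInᵢ≢i j i))) ⟩
    f j + 0#                    ≈⟨ +-identityʳ (f j) ⟩
    f j                         ∎

  sumF-antisymmetric : ∀ {m} (T : Fin m → Fin m → Carrier) → (∀ i → T i i ≈ 0#) →
                       (∀ i j → T i j ≈ - T j i) → sumF (λ i → sumF (T i)) ≈ 0#
  sumF-antisymmetric {zero}  T diag anti = refl
  sumF-antisymmetric {suc m} T diag anti = begin
    (T zero zero + sumF (T zero ∘ suc)) + sumF (λ i → T (suc i) zero + sumF (T (suc i) ∘ suc))
      ≈⟨ +-congˡ (sumF-+ (λ i → T (suc i) zero) (λ i → sumF (T (suc i) ∘ suc))) ⟩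
    (T zero zero + sumF (T zero ∘ suc)) + (X + sumF (λ i → sumF (T (suc i) ∘ suc)))
      ≈⟨ +-cong (+-cong (diag zero) first-row) (+-congˡ rest) ⟩
    (0# + - X) + (X + 0#)  ≈⟨ +-cong (+-identityˡ (- X)) (+-identityʳ X) ⟩
    - X + X                ≈⟨ -‿inverseˡ X ⟩
    0#                     ∎
    where
    X = sumF (λ i → T (suc i) zero)
    first-row : sumF (T zero ∘ suc) ≈ - X
    first-row = trans (sumF-cong (λ j → anti zero (suc j))) (sym (sumF-neg (λ i → T (suc i) zero)))
    rest : sumF (λ i → sumF (T (suc i) ∘ suc)) ≈ 0#
    rest = sumF-antisymmetric (λ i j → T (suc i) (suc j)) (diag ∘ suc) (λ i j → anti (suc i) (suc j))

  sumF-inject≤ : ∀ {p q} (p≤q : p ≤ q) (f : Fin q → Carrier) → (∀ t → p ≤ toℕ t → f t ≈ 0#) →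
                 sumF f ≈ sumF (λ t → f (inject≤ t p≤q))
  sumF-inject≤ {zero}          p≤q f f≈0 = sumF-zero (λ t → f≈0 t ℕ.z≤n)
  sumF-inject≤ {suc p} {suc q} p≤q f f≈0 =
    +-congˡ (sumF-inject≤ (ℕ.s≤s⁻¹ p≤q) (f ∘ suc) (λ t p≤t → f≈0 (suc t) (ℕ.s≤s p≤t)))

  altSign-cong : ∀ {m} (j : Fin m) {x y} → x ≈ y → altSign j x ≈ altSign j y
  altSign-cong zero    x≈y = x≈y
  altSign-cong (suc j) x≈y = -‿cong (altSign-cong j x≈y)

  altSign-neg : ∀ {m} (j : Fin m) x → altSign j (- x) ≈ - altSign j x
  altSign-neg zero    x = refl
  altSign-neg (suc j) x = -‿cong (altSign-neg j x)

  altSign-*ˡ : ∀ {m} (j : Fin m) x y → altSign j (x * y) ≈ x * altSign j y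
  altSign-*ˡ zero    x y = refl
  altSign-*ˡ (suc j) x y = trans (-‿cong (altSign-*ˡ j x y)) (-‿distribʳ-* x _)

  altSign-+ : ∀ {m} (j : Fin m) x y → altSign j (x + y) ≈ altSign j x + altSign j y
  altSign-+ zero    x y = refl
  altSign-+ (suc j) x y = trans (-‿cong (altSign-+ j x y)) (sym (-‿+-comm _ _))

  altSign-0# : ∀ {m} (j : Fin m) → altSign j 0# ≈ 0#
  altSign-0# zero    = refl
  altSign-0# (suc j) = trans (-‿cong (altSign-0# j)) -0#≈0#

  altSign-sumF : ∀ {m p} (j : Fin m) (f : Fin p → Carrier) → altSign j (sumF f) ≈ sumF (λ i → altSign j (f i))
  altSign-sumF zero    f = refl
  altSign-sumF (suc j) f = trans (-‿cong (altSign-sumF j f)) (sumF-neg (λ i → altSign j (f i)))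

  altSign²-antisym : ∀ {n} (j c : Fin (suc (suc n))) (j≢c : j ≢ c) (c≢j : c ≢ j) x →
                     altSign j (altSign (punchOut j≢c) x) ≈ - altSign c (altSign (punchOut c≢j) x)
  altSign²-antisym zero    zero    j≢c _ x = contradiction ≡.refl j≢c
  altSign²-antisym zero    (suc c) _   _ x = sym (-‿involutive _)
  altSign²-antisym (suc j) zero    _   _ x = refl
  altSign²-antisym {zero}  (suc zero) (suc zero) j≢c _ x = contradiction ≡.refl j≢c
  altSign²-antisym {suc n} (suc j) (suc c) j≢c c≢j x = begin
    - altSign j (- altSign j′ x)    ≈⟨ -‿cong (altSign-neg j _) ⟩
    - - altSign j (altSign j′ x)    ≈⟨ -‿involutive _ ⟩
    altSign j (altSign j′ x)        ≈⟨ altSign²-antisym j c (j≢c ∘ ≡.cong suc) (c≢j ∘ ≡.cong suc) x ⟩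
    - altSign c (altSign c′ x)      ≈⟨ altSign-neg c _ ⟨
    altSign c (- altSign c′ x)      ≈⟨ -‿involutive _ ⟨
    - - altSign c (- altSign c′ x)  ∎
    where
    j′ = punchOut (j≢c ∘ ≡.cong suc)
    c′ = punchOut (c≢j ∘ ≡.cong suc)

  PlusMinusOne : Carrier → Set ℓ
  PlusMinusOne x = x ≈ 1# ⊎ x ≈ - 1#

  plusMinusOne-cong : ∀ {x y} → x ≈ y → PlusMinusOne y → PlusMinusOne x
  plusMinusOne-cong x≈y (inj₁ y≈1)  = inj₁ (trans x≈y y≈1)
  plusMinusOne-cong x≈y (inj₂ y≈-1) = inj₂ (trans x≈y y≈-1)

  plusMinusOne-altSign : ∀ {m} (j : Fin m) {x} → PlusMinusOne x → PlusMinusOne (altSign j x)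
  plusMinusOne-altSign zero    ±1 = ±1
  plusMinusOne-altSign (suc j) ±1 with plusMinusOne-altSign j ±1
  ... | inj₁ y≈1  = inj₂ (-‿cong y≈1)
  ... | inj₂ y≈-1 = inj₁ (trans (-‿cong y≈-1) (-‿involutive 1#))

  plusMinusOne≉0# : ¬ 1# ≈ 0# → ∀ {x} → PlusMinusOne x → ¬ x ≈ 0#
  plusMinusOne≉0# 1≉0 (inj₁ x≈1)  x≈0 = 1≉0 (trans (sym x≈1) x≈0)
  plusMinusOne≉0# 1≉0 (inj₂ x≈-1) x≈0 =
    1≉0 (trans (sym (-‿involutive 1#)) (trans (-‿cong (trans (sym x≈-1) x≈0)) -0#≈0#))

  minor : ∀ {m} → Mat Carrier (suc m) (suc m) → Fin (suc m) → Mat Carrier m m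
  minor A j a b = A (suc a) (punchIn j b)

  laplaceTerm : ∀ {m} → Mat Carrier (suc m) (suc m) → Fin (suc m) → Carrier
  laplaceTerm A j = altSign j (A zero j * det (minor A j))

  det-cong : ∀ {m} {A B : Mat Carrier m m} → (∀ a b → A a b ≈ B a b) → det A ≈ det B
  det-cong {zero}  A≈B = refl
  det-cong {suc m} A≈B = sumF-cong (λ j → altSign-cong j
    (*-cong (A≈B zero j) (det-cong (λ a b → A≈B (suc a) (punchIn j b)))))

  laplaceTerm-zeroˡ : ∀ {m} (A : Mat Carrier (suc m) (suc m)) j → A zero j ≈ 0# → laplaceTerm A j ≈ 0#
  laplaceTerm-zeroˡ A j A₀ⱼ≈0 = trans (altSign-cong j (trans (*-congʳ A₀ⱼ≈0) (zeroˡ _))) (altSign-0# j)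

  laplaceTerm-zeroʳ : ∀ {m} (A : Mat Carrier (suc m) (suc m)) j → det (minor A j) ≈ 0# → laplaceTerm A j ≈ 0#
  laplaceTerm-zeroʳ A j minor≈0 = trans (altSign-cong j (trans (*-congˡ minor≈0) (zeroʳ _))) (altSign-0# j)

  det-zero-row : ∀ {m} (A : Mat Carrier m m) (a : Fin m) → (∀ b → A a b ≈ 0#) → det A ≈ 0#
  det-zero-row {suc m} A zero    A₀≈0 = sumF-zero (λ j → laplaceTerm-zeroˡ A j (A₀≈0 j))
  det-zero-row {suc m} A (suc a) Aₐ≈0 =
    sumF-zero (λ j → laplaceTerm-zeroʳ A j (det-zero-row (minor A j) a (Aₐ≈0 ∘ punchIn j)))

  det-zero-column : ∀ {m} (A : Mat Carrier m m) (b : Fin m) → (∀ r → A r b ≈ 0#) → det A ≈ 0#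
  det-zero-column {suc m} A b A-b≈0 = sumF-zero vanish
    where
    vanish : ∀ j → laplaceTerm A j ≈ 0#
    vanish j with j ≟ b
    ... | yes ≡.refl = laplaceTerm-zeroˡ A j (A-b≈0 zero)
    ... | no  j≢b    = laplaceTerm-zeroʳ A j (det-zero-column (minor A j) (punchOut j≢b)
                         (λ r → trans (reflexive (≡.cong (A (suc r)) (punchIn-punchOut j≢b))) (A-b≈0 (suc r))))

  AgreeOffRow : ∀ {m n} → Fin m → Mat Carrier m n → Mat Carrier m n → Set ℓ
  AgreeOffRow a A B = ∀ r → r ≢ a → ∀ b → A r b ≈ B r b

  private
    *-distribʳ-+-scaled : ∀ p q x y z → (p * x + q * y) * z ≈ p * (x * z) + q * (y * z)
    *-distribʳ-+-scaled p q x y z = trans (distribʳ z (p * x) (q * y)) (+-cong (*-assoc p x z) (*-assoc q y z))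

    *-distribˡ-+-scaled : ∀ p q x y z → z * (p * x + q * y) ≈ p * (z * x) + q * (z * y)
    *-distribˡ-+-scaled p q x y z = trans (distribˡ z (p * x) (q * y)) (+-cong (x∙yz≈y∙xz z p x) (x∙yz≈y∙xz z q y))

  det-linear-expansion : ∀ {m} p q {A B C : Mat Carrier (suc m) (suc m)} →
    (∀ j → C zero j * det (minor C j) ≈ p * (A zero j * det (minor A j)) + q * (B zero j * det (minor B j))) →
    det C ≈ p * det A + q * det B
  det-linear-expansion p q {A} {B} {C} termwise = begin
    det C                                                       ≈⟨ sumF-cong signed ⟩
    sumF (λ j → p * laplaceTerm A j + q * laplaceTerm B j)
      ≈⟨ sumF-+ (λ j → p * laplaceTerm A j) (λ j → q * laplaceTerm B j) ⟩
    sumF (λ j → p * laplaceTerm A j) + sumF (λ j → q * laplaceTerm B j)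
      ≈⟨ +-cong (sumF-*ˡ p (laplaceTerm A)) (sumF-*ˡ q (laplaceTerm B)) ⟨
    p * det A + q * det B                                       ∎
    where
    signed : ∀ j → laplaceTerm C j ≈ p * laplaceTerm A j + q * laplaceTerm B j
    signed j = trans (altSign-cong j (termwise j))
      (trans (altSign-+ j _ _) (+-cong (altSign-*ˡ j p _) (altSign-*ˡ j q _)))

  det-linear-row : ∀ {m} (a : Fin m) p q {A B C : Mat Carrier m m} → AgreeOffRow a A C → AgreeOffRow a B C →
                   (∀ b → C a b ≈ p * A a b + q * B a b) → det C ≈ p * det A + q * det B
  det-linear-row {suc m} zero p q {A} {B} {C} A~C B~C C₀ = det-linear-expansion p q {A} {B} {C} (λ j → begin
    C zero j * det (minor C j)                       ≈⟨ *-congʳ (C₀ j) ⟩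
    (p * A zero j + q * B zero j) * det (minor C j)  ≈⟨ *-distribʳ-+-scaled p q _ _ _ ⟩
    p * (A zero j * det (minor C j)) + q * (B zero j * det (minor C j))
      ≈⟨ +-cong (*-congˡ (*-congˡ (det-cong (λ a b → sym (A~C (suc a) (λ ()) (punchIn j b))))))
                (*-congˡ (*-congˡ (det-cong (λ a b → sym (B~C (suc a) (λ ()) (punchIn j b)))))) ⟩
    p * (A zero j * det (minor A j)) + q * (B zero j * det (minor B j)) ∎)
  det-linear-row {suc m} (suc a) p q {A} {B} {C} A~C B~C Cₐ = det-linear-expansion p q {A} {B} {C} (λ j → begin
    C zero j * det (minor C j)  ≈⟨ *-congˡ (det-linear-row a p q (minor-agree A~C j) (minor-agree B~C j) (Cₐ ∘ punchIn j)) ⟩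
    C zero j * (p * det (minor A j) + q * det (minor B j))  ≈⟨ *-distribˡ-+-scaled p q _ _ _ ⟩
    p * (C zero j * det (minor A j)) + q * (C zero j * det (minor B j))
      ≈⟨ +-cong (*-congˡ (*-congʳ (sym (A~C zero (λ ()) j)))) (*-congˡ (*-congʳ (sym (B~C zero (λ ()) j)))) ⟩
    p * (A zero j * det (minor A j)) + q * (B zero j * det (minor B j)) ∎)
    where
    minor-agree : ∀ {X} → AgreeOffRow (suc a) X C → ∀ j → AgreeOffRow a (minor X j) (minor C j)
    minor-agree X~C j r r≢a b = X~C (suc r) (r≢a ∘ suc-injective) (punchIn j b)

  withRow : ∀ {m n} → Mat Carrier m n → Fin m → (Fin n → Carrier) → Mat Carrier m n
  withRow A a x = updateAt A a (λ _ → x)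

  withRow-same : ∀ {m n} (A : Mat Carrier m n) a x b → withRow A a x a b ≡ x b
  withRow-same A a x b = ≡.cong-app (updateAt-updates a A) b

  withRow-other : ∀ {m n} (A : Mat Carrier m n) {a r} x b → r ≢ a → withRow A a x r b ≡ A r b
  withRow-other A {a} {r} x b r≢a = ≡.cong-app (updateAt-minimal r a A r≢a) b

  withRow-agree : ∀ {m n} (A : Mat Carrier m n) a x → AgreeOffRow a (withRow A a x) A
  withRow-agree A a x r r≢a b = reflexive (withRow-other A x b r≢a)

  withRow-withRow : ∀ {m n} (A : Mat Carrier m n) a x y r b → withRow (withRow A a x) a y r b ≡ withRow A a y r b
  withRow-withRow A a x y r b with r ≟ a
  ... | yes ≡.refl = ≡.trans (withRow-same _ a y b) (≡.sym (withRow-same A a y b))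
  ... | no  r≢a    = ≡.trans (withRow-other _ y b r≢a)
                       (≡.trans (withRow-other A x b r≢a) (≡.sym (withRow-other A y b r≢a)))

  det-row-sum : ∀ {m p} (a : Fin m) (c : Fin p → Carrier) (Y : Fin p → Fin m → Carrier) (C : Mat Carrier m m) →
                (∀ b → C a b ≈ sumF (λ t → c t * Y t b)) → det C ≈ sumF (λ t → c t * det (withRow C a (Y t)))
  det-row-sum {p = zero}  a c Y C Cₐ = det-zero-row C a Cₐ
  det-row-sum {p = suc p} a c Y C Cₐ = begin
    det C                                                 ≈⟨ det-linear-row a (c zero) 1# agree-head agree-tail row-a ⟩
    c zero * det (withRow C a (Y zero)) + 1# * det C′     ≈⟨ +-congˡ (trans (*-identityˡ (det C′)) tail) ⟩
    c zero * det (withRow C a (Y zero)) + sumF (λ t → c (suc t) * det (withRow C a (Y (suc t)))) ∎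
    where
    C′ = withRow C a (λ b → sumF (λ t → c (suc t) * Y (suc t) b))
    agree-head : AgreeOffRow a (withRow C a (Y zero)) C
    agree-head = withRow-agree C a (Y zero)
    agree-tail : AgreeOffRow a C′ C
    agree-tail = withRow-agree C a _
    row-a : ∀ b → C a b ≈ c zero * withRow C a (Y zero) a b + 1# * C′ a b
    row-a b = trans (Cₐ b) (+-cong (*-congˡ (reflexive (≡.sym (withRow-same C a (Y zero) b))))
                                   (trans (sym (*-identityˡ _)) (*-congˡ (reflexive (≡.sym (withRow-same C a _ b))))))
    tail : det C′ ≈ sumF (λ t → c (suc t) * det (withRow C a (Y (suc t))))
    tail = trans (det-row-sum a (c ∘ suc) (Y ∘ suc) C′ (λ b → reflexive (withRow-same C a _ b)))
                 (sumF-cong (λ t → *-congˡ (det-cong (λ r b → reflexive (withRow-withRow C a _ (Y (suc t)) r b)))))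

  -- The term of the expansion along the two top rows that takes row 0 at column j and row 1 at column c.
  pairTermOf : ∀ {m} → Mat Carrier (suc (suc m)) (suc (suc m)) → (j c : Fin (suc (suc m))) → j ≢ c → Carrier
  pairTermOf A j c j≢c =
    altSign j (A zero j * altSign (punchOut j≢c) (A (suc zero) c * det (minor (minor A j) (punchOut j≢c))))

  pairTerm : ∀ {m} → Mat Carrier (suc (suc m)) (suc (suc m)) → Fin (suc (suc m)) → Fin (suc (suc m)) → Carrier
  pairTerm A j c with j ≟ c
  ... | yes _   = 0#
  ... | no  j≢c = pairTermOf A j c j≢c

  pairTerm-diag : ∀ {m} (A : Mat Carrier (suc (suc m)) (suc (suc m))) j → pairTerm A j j ≈ 0#
  pairTerm-diag A j with j ≟ j
  ... | yes _   = refl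
  ... | no  j≢j = contradiction ≡.refl j≢j

  pairTerm-≢ : ∀ {m} (A : Mat Carrier (suc (suc m)) (suc (suc m))) {j c} (j≢c : j ≢ c) →
               pairTerm A j c ≈ pairTermOf A j c j≢c
  pairTerm-≢ A {j} {c} j≢c with j ≟ c
  ... | yes j≡c  = contradiction j≡c j≢c
  ... | no  j≢c′ = reflexive (≡.cong (λ x → altSign j (A zero j * altSign x (A (suc zero) c * det (minor (minor A j) x))))
                                     (punchOut-cong j ≡.refl))

  det-double-expansion : ∀ {m} (A : Mat Carrier (suc (suc m)) (suc (suc m))) →
                         det A ≈ sumF (λ j → sumF (pairTerm A j))
  det-double-expansion A = sumF-cong row
    where
    row : ∀ j → laplaceTerm A j ≈ sumF (pairTerm A j)
    row j = begin
      laplaceTerm A j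
        ≈⟨ altSign-cong j (sumF-*ˡ (A zero j) (laplaceTerm (minor A j))) ⟩
      altSign j (sumF (λ x → A zero j * laplaceTerm (minor A j) x))
        ≈⟨ altSign-sumF j (λ x → A zero j * laplaceTerm (minor A j) x) ⟩
      sumF (λ x → altSign j (A zero j * laplaceTerm (minor A j) x))
        ≈⟨ sumF-cong (λ x → trans (reflexive (≡.cong (λ y → altSign j (A zero j * altSign y (A (suc zero) (punchIn j x)
                                                      * det (minor (minor A j) y)))) (≡.sym (punchOut-punchIn j))))
                                  (sym (pairTerm-≢ A (≢-sym (punchInᵢ≢i j x))))) ⟩
      sumF (pairTerm A j ∘ punchIn j)                       ≈⟨ +-identityˡ _ ⟨
      0# + sumF (pairTerm A j ∘ punchIn j)                  ≈⟨ +-congʳ (pairTerm-diag A j) ⟨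
      pairTerm A j j + sumF (pairTerm A j ∘ punchIn j)      ≈⟨ sumF-remove j (pairTerm A j) ⟨
      sumF (pairTerm A j)                                   ∎

  TopRowsSwapped : ∀ {m n} → Mat Carrier (suc (suc m)) n → Mat Carrier (suc (suc m)) n → Set ℓ
  TopRowsSwapped A B = (∀ b → B zero b ≈ A (suc zero) b) × (∀ b → B (suc zero) b ≈ A zero b)
                     × (∀ r b → B (suc (suc r)) b ≈ A (suc (suc r)) b)

  altSign²-*ˡ : ∀ {m n} (j : Fin m) (x : Fin n) a b d → altSign j (a * altSign x (b * d)) ≈ a * (b * altSign j (altSign x d))
  altSign²-*ˡ j x a b d = trans (altSign-*ˡ j a _) (*-congˡ (trans (altSign-cong j (altSign-*ˡ x b d)) (altSign-*ˡ j b _)))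

  pairTerm-swap : ∀ {m} {A B : Mat Carrier (suc (suc m)) (suc (suc m))} → TopRowsSwapped A B →
                  ∀ j c → pairTerm B j c ≈ - pairTerm A c j
  pairTerm-swap {A = A} {B} (B₀ , B₁ , B₊) j c = by-cases (j ≟ c)
    where
    by-cases : Dec (j ≡ c) → pairTerm B j c ≈ - pairTerm A c j
    by-cases (yes ≡.refl) = trans (pairTerm-diag B j) (sym (trans (-‿cong (pairTerm-diag A j)) -0#≈0#))
    by-cases (no j≢c) = begin
      pairTerm B j c                                               ≈⟨ pairTerm-≢ B j≢c ⟩
      altSign j (B zero j * altSign x (B (suc zero) c * D B j x))  ≈⟨ altSign²-*ˡ j x _ _ _ ⟩
      B zero j * (B (suc zero) c * altSign j (altSign x (D B j x)))
        ≈⟨ *-cong (B₀ j) (*-cong (B₁ c) (altSign-cong j (altSign-cong x (det-cong (λ a b → B₊ a _))))) ⟩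
      A (suc zero) j * (A zero c * altSign j (altSign x (D A j x)))  ≈⟨ x∙yz≈y∙xz _ _ _ ⟩
      A zero c * (A (suc zero) j * altSign j (altSign x (D A j x)))
        ≈⟨ *-congˡ (*-congˡ (altSign²-antisym j c j≢c c≢j _)) ⟩
      A zero c * (A (suc zero) j * - altSign c (altSign x′ (D A j x)))
        ≈⟨ *-congˡ (*-congˡ (-‿cong (altSign-cong c (altSign-cong x′ (det-cong
             (λ a b → reflexive (≡.cong (A (suc (suc a))) (punchIn-punchIn-comm j c j≢c c≢j b)))))))) ⟩
      A zero c * (A (suc zero) j * - altSign c (altSign x′ (D A c x′)))
        ≈⟨ trans (*-congˡ (sym (-‿distribʳ-* _ _))) (sym (-‿distribʳ-* _ _)) ⟩
      - (A zero c * (A (suc zero) j * altSign c (altSign x′ (D A c x′))))  ≈⟨ -‿cong (altSign²-*ˡ c x′ _ _ _) ⟨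
      - pairTermOf A c j c≢j                                       ≈⟨ -‿cong (pairTerm-≢ A c≢j) ⟨
      - pairTerm A c j                                             ∎
      where
      c≢j = ≢-sym j≢c
      x = punchOut j≢c
      x′ = punchOut c≢j
      D : Mat Carrier (suc (suc _)) (suc (suc _)) → (j : Fin _) → Fin _ → Carrier
      D X j y = det (minor (minor X j) y)

  det-swap-top-rows : ∀ {m} {A B : Mat Carrier (suc (suc m)) (suc (suc m))} → TopRowsSwapped A B → det B ≈ - det A
  det-swap-top-rows {A = A} {B} swapped = begin
    det B                                        ≈⟨ det-double-expansion B ⟩
    sumF (λ j → sumF (pairTerm B j))             ≈⟨ sumF-cong (λ j → sumF-cong (pairTerm-swap {A = A} {B} swapped j)) ⟩
    sumF (λ j → sumF (λ c → - pairTerm A c j))   ≈⟨ sumF-cong (λ j → sumF-neg (λ c → pairTerm A c j)) ⟨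
    sumF (λ j → - sumF (λ c → pairTerm A c j))   ≈⟨ sumF-neg (λ j → sumF (λ c → pairTerm A c j)) ⟨
    - sumF (λ j → sumF (λ c → pairTerm A c j))   ≈⟨ -‿cong (sumF-comm (λ j c → pairTerm A c j)) ⟩
    - sumF (λ c → sumF (pairTerm A c))           ≈⟨ -‿cong (det-double-expansion A) ⟨
    - det A                                      ∎

  det-equal-top-rows : ∀ {m} (A : Mat Carrier (suc (suc m)) (suc (suc m))) →
                       (∀ b → A zero b ≈ A (suc zero) b) → det A ≈ 0#
  det-equal-top-rows A A₀≈A₁ = trans (det-double-expansion A)
    (sumF-antisymmetric (pairTerm A) (pairTerm-diag A) (pairTerm-swap {A = A} (A₀≈A₁ , sym ∘ A₀≈A₁ , λ _ _ → refl)))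

  swapTopRows : ∀ {m n} → Mat Carrier (suc (suc m)) n → Mat Carrier (suc (suc m)) n
  swapTopRows A zero          = A (suc zero)
  swapTopRows A (suc zero)    = A zero
  swapTopRows A (suc (suc r)) = A (suc (suc r))

  -- Exchanging the top rows moves the copy of row 0 to row 1, where the expansion along row 0 reaches it.
  det-equal-rows-zero : ∀ {m} (A : Mat Carrier (suc (suc m)) (suc (suc m))) (k : Fin (suc m)) →
                        (∀ b → A zero b ≈ A (suc k) b) → det A ≈ 0#
  det-equal-rows-zero         A zero    A₀≈A₁ = det-equal-top-rows A A₀≈A₁
  det-equal-rows-zero {suc m} A (suc k) A₀≈Aₖ = begin
    det A                  ≈⟨ -‿involutive (det A) ⟨
    - - det A              ≈⟨ -‿cong (det-swap-top-rows {A = A} {swapTopRows A}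
                                        ((λ _ → refl) , (λ _ → refl) , (λ _ _ → refl))) ⟨
    - det (swapTopRows A)  ≈⟨ -‿cong (sumF-zero (λ j → laplaceTerm-zeroʳ (swapTopRows A) j
                                (det-equal-rows-zero (minor (swapTopRows A) j) k (A₀≈Aₖ ∘ punchIn j)))) ⟩
    - 0#                   ≈⟨ -0#≈0# ⟩
    0#                     ∎

  det-equal-rows-< : ∀ {m} (A : Mat Carrier m m) {t k : Fin m} → t < k → (∀ b → A t b ≈ A k b) → det A ≈ 0#
  det-equal-rows-< {suc (suc m)} A {zero}  {suc k} _   Aₜ≈Aₖ = det-equal-rows-zero A k Aₜ≈Aₖ
  det-equal-rows-< {suc m}       A {suc t} {suc k} t<k Aₜ≈Aₖ = sumF-zero (λ j → laplaceTerm-zeroʳ A j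
    (det-equal-rows-< (minor A j) (ℕ.s≤s⁻¹ t<k) (Aₜ≈Aₖ ∘ punchIn j)))

  det-equal-rows : ∀ {m} (A : Mat Carrier m m) {t k : Fin m} → t ≢ k → (∀ b → A t b ≈ A k b) → det A ≈ 0#
  det-equal-rows A {t} {k} t≢k Aₜ≈Aₖ with <-cmp t k
  ... | tri< t<k _ _ = det-equal-rows-< A t<k Aₜ≈Aₖ
  ... | tri≈ _ t≡k _ = contradiction t≡k t≢k
  ... | tri> _ _ k<t = det-equal-rows-< A k<t (sym ∘ Aₜ≈Aₖ)

  -- Unitriangular factors

  module _ {m p} (ρ : Fin m → Fin p) (ρ-injective : Injective _≡_ _≡_ ρ) (L Q : Mat Carrier m m)
           (L-diag : ∀ a → L a a ≈ 1#) (L-triangular : ∀ a t → ρ a < ρ t → L a t ≈ 0#) where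

    private
      partial : ℕ → Mat Carrier m m
      partial k r = if does (toℕ (ρ r) ℕ.<? k) then Q r else (L ⊗ Q) r

      partial-below : ∀ {k r} → toℕ (ρ r) ℕ.< k → partial k r ≡ Q r
      partial-below {k} {r} ρr<k = ≡.cong (if_then Q r else (L ⊗ Q) r) (dec-true (toℕ (ρ r) ℕ.<? k) ρr<k)

      partial-above : ∀ {k r} → ¬ toℕ (ρ r) ℕ.< k → partial k r ≡ (L ⊗ Q) r
      partial-above {k} {r} ρr≮k = ≡.cong (if_then Q r else (L ⊗ Q) r) (dec-false (toℕ (ρ r) ℕ.<? k) ρr≮k)

      partial-unchanged : ∀ {k} r → toℕ (ρ r) ≢ k → partial k r ≡ partial (suc k) r
      partial-unchanged {k} r ρr≢k = by-cases (toℕ (ρ r) ℕ.<? k)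
        where
        by-cases : Dec (toℕ (ρ r) ℕ.< k) → partial k r ≡ partial (suc k) r
        by-cases (yes ρr<k) = ≡.trans (partial-below ρr<k) (≡.sym (partial-below (ℕ.m<n⇒m<1+n ρr<k)))
        by-cases (no  ρr≮k) = ≡.trans (partial-above ρr≮k)
                                (≡.sym (partial-above ([ ρr≮k , ρr≢k ]′ ∘ ℕ.m<1+n⇒m<n∨m≡n)))

      partial-step : ∀ k → det (partial k) ≈ det (partial (suc k))
      partial-step k with any? (λ a → toℕ (ρ a) ℕ.≟ k)
      ... | no  ∄a       = det-cong (λ r b → reflexive (≡.cong-app (partial-unchanged r (∄a ∘ (r ,_))) b))
      ... | yes (a , ρa≡k) = begin
        det (partial k)                                          ≈⟨ det-row-sum a (L a) Q (partial k) row-a ⟩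
        sumF (λ t → L a t * det (withRow (partial k) a (Q t)))   ≈⟨ sumF-single a off-diagonal ⟩
        L a a * det (withRow (partial k) a (Q a))                ≈⟨ trans (*-congʳ (L-diag a)) (*-identityˡ _) ⟩
        det (withRow (partial k) a (Q a))                        ≈⟨ det-cong (λ r b → reflexive (replaced r b)) ⟩
        det (partial (suc k))                                    ∎
        where
        other-rank : ∀ r → r ≢ a → toℕ (ρ r) ≢ k
        other-rank r r≢a ρr≡k = r≢a (ρ-injective (toℕ-injective (≡.trans ρr≡k (≡.sym ρa≡k))))

        row-a : ∀ b → partial k a b ≈ (L ⊗ Q) a b
        row-a b = reflexive (≡.cong-app (partial-above (λ ρa<k → ℕ.<-irrefl ρa≡k ρa<k)) b)

        -- rows of lower rank already agree with Q, and L vanishes towards higher rank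
        off-diagonal : ∀ t → t ≢ a → L a t * det (withRow (partial k) a (Q t)) ≈ 0#
        off-diagonal t t≢a with toℕ (ρ t) ℕ.<? k
        ... | yes ρt<k = trans (*-congˡ (det-equal-rows _ t≢a (λ b → reflexive (≡.trans
                            (withRow-other (partial k) (Q t) b t≢a)
                            (≡.trans (≡.cong-app (partial-below ρt<k) b) (≡.sym (withRow-same (partial k) a (Q t) b)))))))
                           (zeroʳ _)
        ... | no  ρt≮k = trans (*-congʳ (L-triangular a t ρa<ρt)) (zeroˡ _)
          where
          ρa<ρt : ρ a < ρ t
          ρa<ρt = ℕ.≤∧≢⇒< (≡.subst (ℕ._≤ toℕ (ρ t)) (≡.sym ρa≡k) (ℕ.≮⇒≥ ρt≮k))
                           (λ ρa≡ρt → other-rank t t≢a (≡.trans (≡.sym ρa≡ρt) ρa≡k))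

        replaced : ∀ r b → withRow (partial k) a (Q a) r b ≡ partial (suc k) r b
        replaced r b with r ≟ a
        ... | yes ≡.refl = ≡.trans (withRow-same (partial k) a (Q a) b)
                             (≡.sym (≡.cong-app (partial-below (ℕ.≤-reflexive (≡.cong suc ρa≡k))) b))
        ... | no  r≢a    = ≡.trans (withRow-other (partial k) (Q a) b r≢a)
                             (≡.cong-app (partial-unchanged r (other-rank r r≢a)) b)

      partial-from-zero : ∀ k → det (partial 0) ≈ det (partial k)
      partial-from-zero zero    = refl
      partial-from-zero (suc k) = trans (partial-from-zero k) (partial-step k)

    det-⊗-unitriangular : det (L ⊗ Q) ≈ det Q
    det-⊗-unitriangular = begin
      det (L ⊗ Q)      ≈⟨ det-cong (λ r b → reflexive (≡.cong-app (partial-above ℕ.n≮0) b)) ⟨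
      det (partial 0)  ≈⟨ partial-from-zero p ⟩
      det (partial p)  ≈⟨ det-cong (λ r b → reflexive (≡.cong-app (partial-below (toℕ<n (ρ r))) b)) ⟩
      det Q            ∎

  det-permutation-matrix : ∀ {m} (π : Permutation′ m) (A : Mat Carrier m m) →
                           (∀ r b → π ⟨$⟩ʳ b ≡ r → A r b ≈ 1#) →
                           (∀ r b → π ⟨$⟩ʳ b ≢ r → A r b ≈ 0#) → PlusMinusOne (det A)
  det-permutation-matrix {zero}  π A A≈1 A≈0 = inj₁ refl
  det-permutation-matrix {suc m} π A A≈1 A≈0 =
    plusMinusOne-cong expansion (plusMinusOne-altSign b₀ (det-permutation-matrix π′ (minor A b₀) minor≈1 minor≈0))
    where
    b₀ = π ⟨$⟩ˡ zero
    π′ = Perm.remove b₀ π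

    shifted : ∀ c → π ⟨$⟩ʳ punchIn b₀ c ≡ suc (π′ ⟨$⟩ʳ c)
    shifted = Perm.punchIn-permute′ π zero

    minor≈1 : ∀ r c → π′ ⟨$⟩ʳ c ≡ r → minor A b₀ r c ≈ 1#
    minor≈1 r c π′c≡r = A≈1 (suc r) (punchIn b₀ c) (≡.trans (shifted c) (≡.cong suc π′c≡r))

    minor≈0 : ∀ r c → π′ ⟨$⟩ʳ c ≢ r → minor A b₀ r c ≈ 0#
    minor≈0 r c π′c≢r = A≈0 (suc r) (punchIn b₀ c) (π′c≢r ∘ suc-injective ∘ ≡.trans (≡.sym (shifted c)))

    expansion : det A ≈ altSign b₀ (det (minor A b₀))
    expansion = trans (sumF-single b₀ (λ b b≢b₀ → laplaceTerm-zeroˡ A b (A≈0 zero b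
                  (λ πb≡0 → b≢b₀ (≡.trans (≡.sym (Perm.inverseˡ π)) (≡.cong (π ⟨$⟩ˡ_) πb≡0))))))
                (altSign-cong b₀ (trans (*-congʳ (A≈1 zero b₀ (Perm.inverseʳ π))) (*-identityˡ _)))

  identity : ∀ {m} → Mat Carrier m m
  identity a b = if does (a ≟ b) then 1# else 0#

  identity-diag : ∀ {m} (a : Fin m) → identity a a ≈ 1#
  identity-diag a = reflexive (≡.cong (if_then 1# else 0#) (dec-true (a ≟ a) ≡.refl))

  identity-off : ∀ {m} {a b : Fin m} → a ≢ b → identity a b ≈ 0#
  identity-off {a = a} {b} a≢b = reflexive (≡.cong (if_then 1# else 0#) (dec-false (a ≟ b) a≢b))

  ⊗-identityˡ : ∀ {m n} (A : Mat Carrier m n) r j → (identity ⊗ A) r j ≈ A r j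
  ⊗-identityˡ A r j = begin
    sumF (λ t → identity r t * A t j)
      ≈⟨ sumF-single r (λ t t≢r → trans (*-congʳ (identity-off (≢-sym t≢r))) (zeroˡ _)) ⟩
    identity r r * A r j               ≈⟨ trans (*-congʳ (identity-diag r)) (*-identityˡ _) ⟩
    A r j                              ∎

  ⊗-lower-triangular : ∀ {k n h} (h≤k : h ≤ k) (U : Mat Carrier k k) (P : Mat Carrier k n) →
    (∀ a t → a < t → U a t ≈ 0#) → ∀ a j →
    (U ⊗ P) (inject≤ a h≤k) j
      ≈ ((λ a t → U (inject≤ a h≤k) (inject≤ t h≤k)) ⊗ (λ t → P (inject≤ t h≤k))) a j
  ⊗-lower-triangular h≤k U P U-lower a j = sumF-inject≤ h≤k (λ t → U (inject≤ a h≤k) t * P t j)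
    (λ t h≤t → trans (*-congʳ (U-lower _ t (≡.subst (ℕ._< toℕ t) (≡.sym (toℕ-inject≤ a h≤k))
                                                 (ℕ.<-≤-trans (toℕ<n a) h≤t))))
                     (zeroˡ _))

-- Fubini words and flag minors

firstOcc-sound : ∀ {n k} (w : Fin n → Fin k) v {p} → firstOcc w v ≡ just p → w p ≡ v
firstOcc-sound {suc n} w v occ with w zero ≟ v
firstOcc-sound {suc n} w v ≡.refl | yes w₀≡v = w₀≡v
firstOcc-sound {suc n} w v occ    | no  _ with firstOcc (λ j → w (suc j)) v in occ′
firstOcc-sound {suc n} w v ≡.refl | no  _ | just p = firstOcc-sound (λ j → w (suc j)) v occ′

firstOcc-complete : ∀ {n k} (w : Fin n → Fin k) {v} → (∃ λ j → w j ≡ v) → ∃ λ p → firstOcc w v ≡ just p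
firstOcc-complete {suc n} w {v} (j , wj≡v) with w zero ≟ v
... | yes _ = zero , ≡.refl
firstOcc-complete {suc n} w {v} (zero  , w₀≡v) | no w₀≢v = contradiction w₀≡v w₀≢v
firstOcc-complete {suc n} w {v} (suc j , wj≡v) | no _ =
  let p , occ = firstOcc-complete (λ j → w (suc j)) (j , wj≡v) in suc p , ≡.cong (map suc) occ

Mw-≡ : ∀ {a} {A : Set a} (z o : A) {n k} (w : Fin n → Fin k) {r j} → w j ≡ r → Mw z o w r j ≡ o
Mw-≡ z o w {r} {j} wj≡r with w j ≟ r
... | yes _    = ≡.refl
... | no  wj≢r = contradiction wj≡r wj≢r

Mw-≢ : ∀ {a} {A : Set a} (z o : A) {n k} (w : Fin n → Fin k) {r j} → w j ≢ r → Mw z o w r j ≡ z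
Mw-≢ z o w {r} {j} wj≢r with w j ≟ r
... | yes wj≡r = contradiction wj≡r wj≢r
... | no  _    = ≡.refl

Mwℕ≡1 : ∀ {n k} (w : Fin n → Fin k) {r j} → Mwℕ w r j ≡ 1 → w j ≡ r
Mwℕ≡1 w {r} {j} Mrj≡1 with w j ≟ r
... | yes wj≡r = wj≡r
... | no  _    = contradiction Mrj≡1 λ ()

module FlagMinor {c ℓ : Level} (R : CommutativeRing c ℓ) {n k h : ℕ}
                 (w : Fin n → Fin k) (h≤k : h ≤ k) (J : Fin h → Fin n) where

  open CommutativeRing R hiding (zero)
  open RingDefs R
  open Determinant R
  open import Relation.Binary.Reasoning.Setoid setoid

  row : Fin h → Fin k
  row a = inject≤ a h≤k

  row-injective : Injective _≡_ _≡_ row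
  row-injective = inject≤-injective h≤k h≤k _ _

  -- f b is the row of M_w[[h],J] carrying the 1 of column b
  ColumnRows : (Fin h → Fin h) → Set
  ColumnRows f = ∀ b → w (J b) ≡ row (f b)

  module _ {a} {A : Set a} (z o : A) {f : Fin h → Fin h} (columnRows : ColumnRows f) where

    subMatrix-Mw-≡ : ∀ {r b} → f b ≡ r → subMatrix (Mw z o w) h≤k J r b ≡ o
    subMatrix-Mw-≡ {b = b} fb≡r = Mw-≡ z o w (≡.trans (columnRows b) (≡.cong row fb≡r))

    subMatrix-Mw-≢ : ∀ {r b} → f b ≢ r → subMatrix (Mw z o w) h≤k J r b ≡ z
    subMatrix-Mw-≢ {b = b} fb≢r = Mw-≢ z o w (fb≢r ∘ row-injective ∘ ≡.trans (≡.sym (columnRows b)))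

  Mw∈C : InC w (MwR w)
  Mw∈C = identity , MwR w , (identity-diag , λ a b a<b → identity-off (<⇒≢ a<b))
       , (λ _ _ _ → refl) , (λ r j → sym (⊗-identityˡ (MwR w) r j))

  InU⇒IsPermMatrix : InU w h≤k J → IsPermMatrix (subMatrix (Mwℕ w) h≤k J)
  InU⇒IsPermMatrix J∈U =
    bijection⇒IsPermMatrix _ f (λ _ _ → subMatrix-Mw-≡ 0 1 columnRows) (λ _ _ → subMatrix-Mw-≢ 0 1 columnRows)
                           f-surjective (surjective⇒injective f f-surjective)
    where
    Δ≉0 : ¬ det (subMatrix (MwR w) h≤k J) ≈ 0#
    Δ≉0 = J∈U (MwR w) Mw∈C

    column : ∀ b → ∃ λ a → w (J b) ≡ row a
    column b with any? (λ a → w (J b) ≟ row a)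
    ... | yes found = found
    ... | no  none  = contradiction (det-zero-column _ b (λ r → reflexive (Mw-≢ 0# 1# w (none ∘ (r ,_))))) Δ≉0

    f : Fin h → Fin h
    f = proj₁ ∘ column

    columnRows : ColumnRows f
    columnRows = proj₂ ∘ column

    f-surjective : ∀ a → ∃ λ b → f b ≡ a
    f-surjective a with any? (λ b → f b ≟ a)
    ... | yes found = found
    ... | no  none  = contradiction (det-zero-row _ a (λ b → reflexive (subMatrix-Mw-≢ 0# 1# columnRows (none ∘ (b ,_)))))
                                    Δ≉0

  Δ-⊗-lowerUnitriangular : ∀ (U : Mat Carrier k k) (P : Mat Carrier k n) {M} → LowerUni U →
                           (∀ r j → M r j ≈ (U ⊗ P) r j) → Δ h≤k J M ≈ det (λ t b → P (row t) (J b))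
  Δ-⊗-lowerUnitriangular U P {M} (U-diag , U-lower) M≈UP = begin
    det (subMatrix M h≤k J)
      ≈⟨ det-cong (λ a b → trans (M≈UP (row a) (J b)) (⊗-lower-triangular h≤k U P U-lower a (J b))) ⟩
    det (L ⊗ Q)              ≈⟨ det-⊗-unitriangular id id L Q (U-diag ∘ row) L-lower ⟩
    det Q                    ∎
    where
    L Q : Mat Carrier h h
    L a t = U (row a) (row t)
    Q t b = P (row t) (J b)

    L-lower : ∀ a t → a < t → L a t ≈ 0#
    L-lower a t a<t = U-lower (row a) (row t)
      (≡.subst₂ ℕ._<_ (≡.sym (toℕ-inject≤ a h≤k)) (≡.sym (toℕ-inject≤ t h≤k)) a<t)

  module _ (w-surjective : Surj w) where

    firstPos : Fin k → Fin n
    firstPos v = proj₁ (firstOcc-complete w (w-surjective v))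

    firstPos-spec : ∀ v → firstOcc w v ≡ just (firstPos v)
    firstPos-spec v = proj₂ (firstOcc-complete w (w-surjective v))

    Star⇒firstPos< : ∀ {r j} → Star w r j → firstPos r < firstPos (w j)
    Star⇒firstPos< {r} {j} (i , wi≡r , i∈in , i<α , _) =
      ≡.subst (_< firstPos (w j)) i≡αr (i<α _ (firstPos-spec (w j)))
      where
      i≡αr : i ≡ firstPos r
      i≡αr = just-injective (≡.trans (≡.sym i∈in) (≡.trans (≡.cong (firstOcc w) wi≡r) (firstPos-spec r)))

    module _ (P : Mat Carrier k n) (P∈Pw : InP w P) (π : Permutation′ h) (columnRows : ColumnRows (π ⟨$⟩ʳ_)) where

      private
        Q Π : Mat Carrier h h
        Q t b = P (row t) (J b)
        Π = subMatrix (MwR w) h≤k J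

        Π≈1 : ∀ r b → π ⟨$⟩ʳ b ≡ r → Π r b ≈ 1#
        Π≈1 r b πb≡r = reflexive (subMatrix-Mw-≡ 0# 1# columnRows πb≡r)

        Π≈0 : ∀ r b → π ⟨$⟩ʳ b ≢ r → Π r b ≈ 0#
        Π≈0 r b πb≢r = reflexive (subMatrix-Mw-≢ 0# 1# columnRows πb≢r)

        κ : Fin h → Fin n
        κ r = firstPos (row r)

        κ-injective : Injective _≡_ _≡_ κ
        κ-injective {r} {r′} κr≡κr′ = row-injective (≡.trans (≡.sym (firstOcc-sound w (row r) (firstPos-spec (row r))))
          (≡.trans (≡.cong w κr≡κr′) (firstOcc-sound w (row r′) (firstPos-spec (row r′)))))

        -- ⋆ entries of P_w only occur where the row letter first occurs before the column letter
        Q≈Π : ∀ {r b} → ¬ κ r < κ (π ⟨$⟩ʳ b) → Q r b ≈ Π r b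
        Q≈Π {r} {b} κr≮κπb =
          P∈Pw (row r) (J b) (κr≮κπb ∘ ≡.subst (λ v → κ r < firstPos v) (columnRows b) ∘ Star⇒firstPos<)

        -- E is unitriangular for the reversed order of first occurrences, whence the use of opposite
        E : Mat Carrier h h
        E r s = Q r (π ⟨$⟩ˡ s)

        E≈Π : ∀ r s → ¬ κ r < κ s → E r s ≈ Π r (π ⟨$⟩ˡ s)
        E≈Π r s κr≮κs = Q≈Π (≡.subst (λ t → ¬ κ r < κ t) (≡.sym (Perm.inverseʳ π)) κr≮κs)

        E-diag : ∀ r → E r r ≈ 1#
        E-diag r = trans (E≈Π r r (<-irrefl ≡.refl)) (Π≈1 r _ (Perm.inverseʳ π))

        E-upper : ∀ r s → opposite (κ r) < opposite (κ s) → E r s ≈ 0#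
        E-upper r s opp-κr<opp-κs =
          trans (E≈Π r s (<-asym κs<κr)) (Π≈0 r _ (κs≢κr ∘ ≡.cong κ ∘ ≡.trans (≡.sym (Perm.inverseʳ π))))
          where
          κs<κr : κ s < κ r
          κs<κr = opposite-<-reflects opp-κr<opp-κs

          κs≢κr : κ s ≢ κ r
          κs≢κr κs≡κr = <-irrefl κs≡κr κs<κr

        Q≈E⊗Π : ∀ r b → Q r b ≈ (E ⊗ Π) r b
        Q≈E⊗Π r b = sym (begin
          sumF (λ s → E r s * Π s b)
            ≈⟨ sumF-single (π ⟨$⟩ʳ b) (λ s s≢πb → trans (*-congˡ (Π≈0 s b (≢-sym s≢πb))) (zeroʳ _)) ⟩
          E r (π ⟨$⟩ʳ b) * Π (π ⟨$⟩ʳ b) b     ≈⟨ trans (*-congˡ (Π≈1 _ b ≡.refl)) (*-identityʳ _) ⟩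
          Q r (π ⟨$⟩ˡ (π ⟨$⟩ʳ b))             ≡⟨ ≡.cong (Q r) (Perm.inverseˡ π) ⟩
          Q r b                               ∎)

      Pw-block-det-plusMinusOne : PlusMinusOne (det (λ t b → P (row t) (J b)))
      Pw-block-det-plusMinusOne = plusMinusOne-cong (begin
        det Q        ≈⟨ det-cong Q≈E⊗Π ⟩
        det (E ⊗ Π)  ≈⟨ det-⊗-unitriangular (opposite ∘ κ) (κ-injective ∘ opposite-injective) E Π E-diag E-upper ⟩
        det Π        ∎) (det-permutation-matrix π Π Π≈1 Π≈0)

    IsPermMatrix⇒InU : ¬ 1# ≈ 0# → IsPermMatrix (subMatrix (Mwℕ w) h≤k J) → InU w h≤k J
    IsPermMatrix⇒InU 1≉0 isPerm M (U , P , U-lowerUni , P∈Pw , M≈UP) =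
      plusMinusOne≉0# 1≉0 (plusMinusOne-cong (Δ-⊗-lowerUnitriangular U P U-lowerUni M≈UP)
                                             (Pw-block-det-plusMinusOne P P∈Pw π columnRows))
      where
      π = proj₁ (IsPermMatrix⇒permutation isPerm)
      columnRows : ColumnRows (π ⟨$⟩ʳ_)
      columnRows b = Mwℕ≡1 w (proj₂ (IsPermMatrix⇒permutation isPerm) b)

lemma3p5 : {c ℓ : Level} (R : CommutativeRing c ℓ)
    → ¬ (CommutativeRing._≈_ R (CommutativeRing.1# R) (CommutativeRing.0# R))
    → (n k : ℕ) → 1 ≤ k → k ≤ n
    → (w : Fin n → Fin k) → Surj w
    → (h : ℕ) → 1 ≤ h → (h≤k : h ≤ k)
    → (J : Fin h → Fin n) → StrictlyIncreasing J
    → (RingDefs.InU R w h≤k J ⇔ IsPermMatrix (subMatrix (Mwℕ w) h≤k J))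
lemma3p5 R 1≉0 n k _ _ w w-surjective h _ h≤k J _ =
  mk⇔ InU⇒IsPermMatrix (IsPermMatrix⇒InU w-surjective 1≉0)
  where open FlagMinor R w h≤k J
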